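{- Let $S\neq\mathbb{N}$ be a numerical set. Then $c_1(\widetilde{S})=c_1(S)-1$.
   Context: $\mathbb{N}=\{0,1,2,\dots\}$. A numerical set is a subset $S\subseteq\mathbb{N}$ with $0\in S$ and $\mathbb{N}\setminus S$ finite. Its gaps are the elements of $\mathbb{N}\setminus S$, and $F(S)$ is its largest gap. Young diagram of $S$: it has one left-justified row for each gap $\ell$. The top row corresponds to $F(S)$, and the gaps decrease going down. The row for $\ell$ has length $|\{s\in S\mid s<\ell\}|$. This is a bijection between numerical sets and Young diagrams, with $\mathbb{N}$ corresponding to the empty diagram. The complement of a Young diagram with rows $\lambda_1\ge\dots\ge\lambda_g$ has rows $\lambda_1-\lambda_g\ge\dots\ge\lambda_1-\lambda_1$, zero rows being discarded. Geometrically, this is the rest of the $g\times\lambda_1$ rectangle rotated by $180^\circ$. The complement $\widetilde{S}$ is the numerical set whose Young diagram is the complement of that of $S$. The hook of a box in a Young diagram consists of the box itself together with all boxes to its right in its row and all boxes below it in its column. The hook length is the number of boxes in the hook. $c_1(S)$ denotes the number of boxes with hook length $1$ in the Young diagram of $S$. -}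

module Defs where

open import Data.Bool using (Bool; true; false; if_then_else_)
open import Data.Nat using (ℕ; zero; suc; _+_; _∸_; _≤_; _<ᵇ_; _≡ᵇ_)
open import Data.List using (List; []; _∷_; map; reverse; upTo)
open import Data.Nat.ListAction using (sum)
open import Relation.Nullary using (¬_)
open import Relation.Binary.PropositionalEquality using (_≡_)

record NumericalSet : Set where
  field
    mem      : ℕ → Bool
    zero∈    : mem 0 ≡ true
    bound    : ℕ
    cofinite : ∀ n → bound ≤ n → mem n ≡ true
open NumericalSet public

IsNat : NumericalSet → Set
IsNat S = ∀ n → mem S n ≡ true

countBelow : (ℕ → Bool) → ℕ → ℕ
countBelow m zero = 0
countBelow m (suc ℓ) = countBelow m ℓ + (if m ℓ then 1 else 0)

gapsBelowDesc : (ℕ → Bool) → ℕ → List ℕ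
gapsBelowDesc m zero = []
gapsBelowDesc m (suc n) = if m n then gapsBelowDesc m n else n ∷ gapsBelowDesc m n

-- A Young diagram is given by its list of row lengths, top row first.
YoungDiagram : Set
YoungDiagram = List ℕ

-- Young diagram of S: one row per gap ℓ (largest gap on top), of length
-- |{ s ∈ S | s < ℓ }|.  (All gaps are below `bound S`.)
young : NumericalSet → YoungDiagram
young S = map (countBelow (mem S)) (gapsBelowDesc (mem S) (bound S))

isNonZero : ℕ → Bool
isNonZero zero = false
isNonZero (suc _) = true

dropZeros : List ℕ → List ℕ
dropZeros [] = []
dropZeros (r ∷ rs) = if isNonZero r then r ∷ dropZeros rs else dropZeros rs

complementDiagram : YoungDiagram → YoungDiagram
complementDiagram [] = []
complementDiagram (l₁ ∷ ls) =
  dropZeros (map (l₁ ∸_) (reverse (l₁ ∷ ls)))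

legCount : List ℕ → ℕ → ℕ
legCount [] j = 0
legCount (r ∷ rs) j = (if j <ᵇ r then 1 else 0) + legCount rs j

hookLength : ℕ → List ℕ → ℕ → ℕ
hookLength r below j = suc ((r ∸ suc j) + legCount below j)

countRow : ℕ → List ℕ → ℕ
countRow r below =
  sum (map (λ j → if hookLength r below j ≡ᵇ 1 then 1 else 0) (upTo r))

c₁Diagram : YoungDiagram → ℕ
c₁Diagram [] = 0
c₁Diagram (r ∷ rs) = countRow r rs + c₁Diagram rs

c₁ : NumericalSet → ℕ
c₁ S = c₁Diagram (young S)

-- The hook-length-1 boxes of a Young diagram are its corners: the ends of
-- the rows that are strictly longer than the row below.  Their number is
-- the number of jumps in the row sequence λ₁ ≥ ⋯ ≥ λ_g ≥ 0 (with a zero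
-- row appended).  Complementation reverses the sequence, replaces each λᵢ
-- by λ₁ - λᵢ and drops zero rows; the first two operations preserve the
-- jumps of a sequence, and the appended zero now coincides with the last
-- entry λ₁ - λ₁, so exactly the jump λ_g > 0 is lost.
module Submission where

open import Defs
open import Data.Bool using (Bool; true; false; if_then_else_)
open import Data.List
  using (List; []; _∷_; _++_; [_]; _∷ʳ_; map; reverse; upTo; filterᵇ)
open import Data.List.Properties
  using (upTo-∷ʳ; map-++; unfold-reverse; reverse-map; ++-assoc)
open import Data.List.Relation.Unary.All as All using (All; []; _∷_)
import Data.List.Relation.Unary.All.Properties as All
open import Data.List.Relation.Unary.AllPairs as AllPairs using (AllPairs; []; _∷_)
import Data.List.Relation.Unary.AllPairs.Properties as AllPairs
open import Data.List.Relation.Binary.Permutation.Propositional using (↭-sym)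
open import Data.List.Relation.Binary.Permutation.Propositional.Properties
  using (All-resp-↭; ↭-reverse)
open import Data.Nat
  using (ℕ; zero; suc; _+_; _∸_; _≤_; _<_; _≥_; _>_; z≤n; s≤s; _<ᵇ_; _≡ᵇ_)
open import Data.Nat.ListAction using (sum)
open import Data.Nat.ListAction.Properties using (sum-++)
open import Data.Nat.Properties
open import Data.Sum using (inj₁; inj₂)
open import Function using (_∘_; flip)
open import Relation.Nullary using (¬_; yes; no; contradiction)
open import Relation.Nullary.Decidable using (dec-true; dec-false)
open import Relation.Binary.PropositionalEquality hiding ([_])
open ≡-Reasoning

Decreasing : List ℕ → Set
Decreasing = AllPairs _≥_

differ : ℕ → ℕ → ℕ
differ zero    zero    = 0
differ zero    (suc _) = 1
differ (suc _) zero    = 1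
differ (suc x) (suc y) = differ x y

jumps : List ℕ → ℕ
jumps []           = 0
jumps (x ∷ [])     = 0
jumps (x ∷ y ∷ ys) = differ x y + jumps (y ∷ ys)

differ-refl : ∀ x → differ x x ≡ 0
differ-refl zero    = refl
differ-refl (suc x) = differ-refl x

differ-≢ : ∀ {x y} → x ≢ y → differ x y ≡ 1
differ-≢ {zero}  {zero}  x≢y = contradiction refl x≢y
differ-≢ {zero}  {suc _} _   = refl
differ-≢ {suc _} {zero}  _   = refl
differ-≢ {suc x} {suc y} x≢y = differ-≢ (x≢y ∘ cong suc)

differ-sym : ∀ x y → differ x y ≡ differ y x
differ-sym zero    zero    = refl
differ-sym zero    (suc _) = refl
differ-sym (suc _) zero    = refl
differ-sym (suc x) (suc y) = differ-sym x y

differ-∸ : ∀ {c x y} → x ≤ c → y ≤ c → differ (c ∸ x) (c ∸ y) ≡ differ x y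
differ-∸ {c} {x} {y} x≤c y≤c with x ≟ y
... | yes refl = trans (differ-refl (c ∸ x)) (sym (differ-refl x))
... | no x≢y   = trans (differ-≢ (x≢y ∘ ∸-cancelˡ-≡ x≤c y≤c)) (sym (differ-≢ x≢y))

<ᵇ-false : ∀ {k r} → r ≤ k → (k <ᵇ r) ≡ false
<ᵇ-false {k} {r} r≤k = dec-false (k <? r) (≤⇒≯ r≤k)

n<ᵇ1+n : ∀ n → (n <ᵇ suc n) ≡ true
n<ᵇ1+n n = dec-true (n <? suc n) (n<1+n n)

sum-map-upTo-suc : ∀ (f : ℕ → ℕ) n →
  sum (map f (upTo (suc n))) ≡ sum (map f (upTo n)) + f n
sum-map-upTo-suc f n = begin
  sum (map f (upTo (suc n)))             ≡⟨ cong (sum ∘ map f) (upTo-∷ʳ n) ⟨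
  sum (map f (upTo n ∷ʳ n))              ≡⟨ cong sum (map-++ f (upTo n) [ n ]) ⟩
  sum (map f (upTo n) ∷ʳ f n)            ≡⟨ sum-++ (map f (upTo n)) [ f n ] ⟩
  sum (map f (upTo n)) + (f n + 0)       ≡⟨ cong (sum (map f (upTo n)) +_) (+-identityʳ (f n)) ⟩
  sum (map f (upTo n)) + f n             ∎

sum-map-upTo-zero : ∀ (f : ℕ → ℕ) n → (∀ {j} → j < n → f j ≡ 0) →
  sum (map f (upTo n)) ≡ 0
sum-map-upTo-zero f zero    f≡0 = refl
sum-map-upTo-zero f (suc n) f≡0 = trans (sum-map-upTo-suc f n)
  (cong₂ _+_ (sum-map-upTo-zero f n (f≡0 ∘ m<n⇒m<1+n)) (f≡0 (n<1+n n)))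

-- Only the last box of a row can have hook length 1: every other box has a
-- nonempty arm.
countRow-suc : ∀ k rows →
  countRow (suc k) rows ≡ (if legCount rows k ≡ᵇ 0 then 1 else 0)
countRow-suc k rows = begin
  countRow (suc k) rows                     ≡⟨ sum-map-upTo-suc hookIs1 k ⟩
  sum (map hookIs1 (upTo k)) + hookIs1 k    ≡⟨ cong (_+ hookIs1 k) (sum-map-upTo-zero hookIs1 k notLast) ⟩
  hookIs1 k                                 ≡⟨ cong (λ arm → if suc (arm + legCount rows k) ≡ᵇ 1 then 1 else 0) (n∸n≡0 k) ⟩
  (if legCount rows k ≡ᵇ 0 then 1 else 0)   ∎
  where
  hookIs1 : ℕ → ℕ
  hookIs1 j = if hookLength (suc k) rows j ≡ᵇ 1 then 1 else 0

  longHook : ∀ {arm} leg → 0 < arm → (suc (arm + leg) ≡ᵇ 1) ≡ false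
  longHook {suc _} _ _ = refl

  notLast : ∀ {j} → j < k → hookIs1 j ≡ 0
  notLast {j} j<k =
    cong (λ b → if b then 1 else 0) (longHook (legCount rows j) (m<n⇒0<n∸m j<k))

legCount-≤ : ∀ {k} rows → All (_≤ k) rows → legCount rows k ≡ 0
legCount-≤ []           []              = refl
legCount-≤ (r ∷ rows) (r≤k ∷ rows≤k) rewrite <ᵇ-false r≤k = legCount-≤ rows rows≤k

countRow-last : ∀ r → countRow r [] ≡ differ r 0
countRow-last zero    = refl
countRow-last (suc k) = countRow-suc k []

countRow-above : ∀ {r s} rows → s ≤ r → All (_≤ s) rows →
  countRow r (s ∷ rows) ≡ differ r s
countRow-above {zero} rows z≤n _ = refl
countRow-above {suc k} {s} rows s≤r rows≤s with suc k ≟ s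
... | yes refl rewrite countRow-suc k (suc k ∷ rows) | n<ᵇ1+n k = sym (differ-refl k)
... | no r≢s = begin
  countRow (suc k) (s ∷ rows)  ≡⟨ countRow-suc k (s ∷ rows) ⟩
  (if legCount (s ∷ rows) k ≡ᵇ 0 then 1 else 0)
    ≡⟨ cong (λ leg → if leg ≡ᵇ 0 then 1 else 0) (legCount-≤ (s ∷ rows) (s≤k ∷ rows≤k)) ⟩
  1                            ≡⟨ differ-≢ r≢s ⟨
  differ (suc k) s             ∎
  where
  s≤k : s ≤ k
  s≤k = ≤-pred (≤∧≢⇒< s≤r (r≢s ∘ sym))
  rows≤k : All (_≤ k) rows
  rows≤k = All.map (λ r≤s → ≤-trans r≤s s≤k) rows≤s

c₁Diagram≡jumps : ∀ {rows} → Decreasing rows → c₁Diagram rows ≡ jumps (rows ∷ʳ 0)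
c₁Diagram≡jumps {[]}    _ = refl
c₁Diagram≡jumps {r ∷ []} _ = cong (_+ 0) (countRow-last r)
c₁Diagram≡jumps {r ∷ s ∷ rows} (r≥ ∷ dec@(s≥ ∷ _)) =
  cong₂ _+_ (countRow-above rows (All.head r≥) s≥) (c₁Diagram≡jumps dec)

jumps-++ : ∀ xs y ys → jumps (xs ++ y ∷ ys) ≡ jumps (xs ∷ʳ y) + jumps (y ∷ ys)
jumps-++ []           y ys = refl
jumps-++ (x ∷ [])     y ys = cong (_+ jumps (y ∷ ys)) (sym (+-identityʳ (differ x y)))
jumps-++ (x ∷ x′ ∷ xs) y ys =
  trans (cong (differ x x′ +_) (jumps-++ (x′ ∷ xs) y ys)) (sym (+-assoc (differ x x′) _ _))

jumps-reverse : ∀ xs → jumps (reverse xs) ≡ jumps xs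
jumps-reverse []           = refl
jumps-reverse (x ∷ [])     = refl
jumps-reverse (x ∷ y ∷ ys) = begin
  jumps (reverse (x ∷ y ∷ ys))                 ≡⟨ cong jumps (unfold-reverse x (y ∷ ys)) ⟩
  jumps (reverse (y ∷ ys) ∷ʳ x)                ≡⟨ cong (λ zs → jumps (zs ∷ʳ x)) (unfold-reverse y ys) ⟩
  jumps ((reverse ys ∷ʳ y) ∷ʳ x)               ≡⟨ cong jumps (++-assoc (reverse ys) [ y ] [ x ]) ⟩
  jumps (reverse ys ++ y ∷ [ x ])              ≡⟨ jumps-++ (reverse ys) y [ x ] ⟩
  jumps (reverse ys ∷ʳ y) + (differ y x + 0)   ≡⟨ cong₂ _+_ (cong jumps (unfold-reverse y ys)) (sym (+-identityʳ _)) ⟨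
  jumps (reverse (y ∷ ys)) + differ y x        ≡⟨ cong₂ _+_ (jumps-reverse (y ∷ ys)) (differ-sym y x) ⟩
  jumps (y ∷ ys) + differ x y                  ≡⟨ +-comm (jumps (y ∷ ys)) (differ x y) ⟩
  jumps (x ∷ y ∷ ys)                           ∎

jumps-map-∸ : ∀ {c} xs → All (_≤ c) xs → jumps (map (c ∸_) xs) ≡ jumps xs
jumps-map-∸ []           _                  = refl
jumps-map-∸ (x ∷ [])     _                  = refl
jumps-map-∸ (x ∷ y ∷ ys) (x≤c ∷ ys≤c@(y≤c ∷ _)) =
  cong₂ _+_ (differ-∸ x≤c y≤c) (jumps-map-∸ (y ∷ ys) ys≤c)

jumps-∷ʳ-0 : ∀ {x xs} → All (0 <_) (x ∷ xs) → jumps ((x ∷ xs) ∷ʳ 0) ≡ suc (jumps (x ∷ xs))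
jumps-∷ʳ-0 {suc _} {[]}    _          = refl
jumps-∷ʳ-0 {x}     {y ∷ ys} (_ ∷ pos) =
  trans (cong (differ x y +_) (jumps-∷ʳ-0 pos)) (+-suc (differ x y) _)

dropZeros≡filterᵇ : ∀ xs → dropZeros xs ≡ filterᵇ isNonZero xs
dropZeros≡filterᵇ []           = refl
dropZeros≡filterᵇ (zero  ∷ xs) = dropZeros≡filterᵇ xs
dropZeros≡filterᵇ (suc x ∷ xs) = cong (suc x ∷_) (dropZeros≡filterᵇ xs)

dropZeros-decreasing : ∀ {xs} → Decreasing xs → Decreasing (dropZeros xs)
dropZeros-decreasing {xs} dec =
  subst Decreasing (sym (dropZeros≡filterᵇ xs)) (AllPairs.filter⁺ _ dec)

dropZeros-≤0 : ∀ {xs} → All (_≤ 0) xs → dropZeros xs ≡ []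
dropZeros-≤0 []          = refl
dropZeros-≤0 (z≤n ∷ xs≤0) = dropZeros-≤0 xs≤0

jumps-0∷-≤0 : ∀ {xs} → All (_≤ 0) xs → jumps (0 ∷ xs ∷ʳ 0) ≡ 0
jumps-0∷-≤0 []          = refl
jumps-0∷-≤0 (z≤n ∷ xs≤0) = jumps-0∷-≤0 xs≤0

-- In a decreasing list the zeros form a tail, which has no jumps once the
-- final 0 is appended.
jumps-dropZeros : ∀ {xs} → Decreasing xs → jumps (dropZeros xs ∷ʳ 0) ≡ jumps (xs ∷ʳ 0)
jumps-dropZeros {[]}    _ = refl
jumps-dropZeros {zero ∷ xs} (xs≤0 ∷ _) rewrite dropZeros-≤0 xs≤0 = sym (jumps-0∷-≤0 xs≤0)
jumps-dropZeros {suc x ∷ []} _ = refl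
jumps-dropZeros {suc x ∷ zero ∷ xs} (_ ∷ xs≤0 ∷ _)
  rewrite dropZeros-≤0 xs≤0 | jumps-0∷-≤0 xs≤0 = refl
jumps-dropZeros {suc x ∷ suc y ∷ xs} (_ ∷ dec) =
  cong (differ (suc x) (suc y) +_) (jumps-dropZeros dec)

All-reverse⁺ : ∀ {A : Set} {P : A → Set} {xs} → All P xs → All P (reverse xs)
All-reverse⁺ {xs = xs} = All-resp-↭ (↭-sym (↭-reverse xs))

AllPairs-reverse⁺ : ∀ {A : Set} {R : A → A → Set} {xs} →
  AllPairs R xs → AllPairs (flip R) (reverse xs)
AllPairs-reverse⁺ {xs = []}     []         = []
AllPairs-reverse⁺ {xs = x ∷ xs} (Rx ∷ Rxs) rewrite unfold-reverse x xs =
  AllPairs.++⁺ (AllPairs-reverse⁺ Rxs) ([] ∷ []) (All.map (_∷ []) (All-reverse⁺ Rx))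

c₁Diagram-complement : ∀ {rows} → Decreasing rows → All (0 <_) rows → rows ≢ [] →
  c₁Diagram (complementDiagram rows) ≡ c₁Diagram rows ∸ 1
c₁Diagram-complement {[]} _ _ []≢[] = contradiction refl []≢[]
c₁Diagram-complement {l ∷ ls} dec@(l≥ls ∷ _) pos _ = begin
  c₁Diagram (dropZeros M)                       ≡⟨ c₁Diagram≡jumps (dropZeros-decreasing M-decreasing) ⟩
  jumps (dropZeros M ∷ʳ 0)                      ≡⟨ jumps-dropZeros M-decreasing ⟩
  jumps (M ∷ʳ 0)                                ≡⟨ cong jumps M∷ʳ0 ⟩
  jumps (map (l ∸_) (reverse (l ∷ l ∷ ls)))     ≡⟨ cong jumps (reverse-map (l ∸_) (l ∷ l ∷ ls)) ⟩
  jumps (reverse (map (l ∸_) (l ∷ l ∷ ls)))     ≡⟨ jumps-reverse (map (l ∸_) (l ∷ l ∷ ls)) ⟩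
  jumps (map (l ∸_) (l ∷ l ∷ ls))               ≡⟨ jumps-map-∸ (l ∷ l ∷ ls) (≤-refl ∷ ≤-refl ∷ l≥ls) ⟩
  differ l l + jumps (l ∷ ls)                   ≡⟨ cong (_+ jumps (l ∷ ls)) (differ-refl l) ⟩
  jumps (l ∷ ls)                                ≡⟨ cong (_∸ 1) (jumps-∷ʳ-0 pos) ⟨
  jumps ((l ∷ ls) ∷ʳ 0) ∸ 1                     ≡⟨ cong (_∸ 1) (c₁Diagram≡jumps dec) ⟨
  c₁Diagram (l ∷ ls) ∸ 1                        ∎
  where
  M : List ℕ
  M = map (l ∸_) (reverse (l ∷ ls))

  M-decreasing : Decreasing M
  M-decreasing = AllPairs.map⁺ (AllPairs.map (∸-monoʳ-≤ l) (AllPairs-reverse⁺ dec))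

  M∷ʳ0 : M ∷ʳ 0 ≡ map (l ∸_) (reverse (l ∷ l ∷ ls))
  M∷ʳ0 = begin
    M ∷ʳ 0                                   ≡⟨ cong (M ∷ʳ_) (n∸n≡0 l) ⟨
    M ∷ʳ (l ∸ l)                             ≡⟨ map-++ (l ∸_) (reverse (l ∷ ls)) [ l ] ⟨
    map (l ∸_) (reverse (l ∷ ls) ∷ʳ l)       ≡⟨ cong (map (l ∸_)) (unfold-reverse l (l ∷ ls)) ⟨
    map (l ∸_) (reverse (l ∷ l ∷ ls))        ∎

module _ (m : ℕ → Bool) where

  gapsBelowDesc-< : ∀ n → All (_< n) (gapsBelowDesc m n)
  gapsBelowDesc-< zero = []
  gapsBelowDesc-< (suc n) with m n
  ... | true  = All.map m<n⇒m<1+n (gapsBelowDesc-< n)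
  ... | false = n<1+n n ∷ All.map m<n⇒m<1+n (gapsBelowDesc-< n)

  gapsBelowDesc-gaps : ∀ n → All (λ g → m g ≡ false) (gapsBelowDesc m n)
  gapsBelowDesc-gaps zero = []
  gapsBelowDesc-gaps (suc n) with m n in mn
  ... | true  = gapsBelowDesc-gaps n
  ... | false = mn ∷ gapsBelowDesc-gaps n

  gapsBelowDesc-strictlyDecreasing : ∀ n → AllPairs _>_ (gapsBelowDesc m n)
  gapsBelowDesc-strictlyDecreasing zero = []
  gapsBelowDesc-strictlyDecreasing (suc n) with m n
  ... | true  = gapsBelowDesc-strictlyDecreasing n
  ... | false = gapsBelowDesc-< n ∷ gapsBelowDesc-strictlyDecreasing n

  gapsBelowDesc≡[] : ∀ n → gapsBelowDesc m n ≡ [] → ∀ {k} → k < n → m k ≡ true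
  gapsBelowDesc≡[] (suc n) noGaps {k} k<1+n with m n in mn
  gapsBelowDesc≡[] (suc n) noGaps {k} k<1+n | true with m≤n⇒m<n∨m≡n (≤-pred k<1+n)
  ... | inj₁ k<n  = gapsBelowDesc≡[] n noGaps k<n
  ... | inj₂ refl = mn

  countBelow-mono : ∀ {a b} → a ≤ b → countBelow m a ≤ countBelow m b
  countBelow-mono {b = zero}  z≤n = ≤-refl
  countBelow-mono {b = suc b} a≤1+b with m≤n⇒m<n∨m≡n a≤1+b
  ... | inj₁ a<1+b = ≤-trans (countBelow-mono (≤-pred a<1+b)) (m≤m+n _ _)
  ... | inj₂ refl  = ≤-refl

  countBelow-positive : m 0 ≡ true → ∀ {g} → m g ≡ false → 0 < countBelow m g
  countBelow-positive m0 {zero}  mg = contradiction (trans (sym m0) mg) λ ()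
  countBelow-positive m0 {suc g} mg =
    ≤-trans (≤-reflexive (cong (λ b → if b then 1 else 0) (sym m0)))
            (countBelow-mono (s≤s z≤n))

young-decreasing : ∀ S → Decreasing (young S)
young-decreasing S = AllPairs.map⁺
  (AllPairs.map (countBelow-mono (mem S) ∘ <⇒≤) (gapsBelowDesc-strictlyDecreasing (mem S) (bound S)))

young-positive : ∀ S → All (0 <_) (young S)
young-positive S = All.map⁺
  (All.map (countBelow-positive (mem S) (zero∈ S)) (gapsBelowDesc-gaps (mem S) (bound S)))

map≡[]⇒≡[] : ∀ {A B : Set} {f : A → B} xs → map f xs ≡ [] → xs ≡ []
map≡[]⇒≡[] []       _  = refl
map≡[]⇒≡[] (_ ∷ _) ()

young≢[] : ∀ S → ¬ IsNat S → young S ≢ []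
young≢[] S S≢ℕ youngS≡[] = S≢ℕ isNat
  where
  noGaps : gapsBelowDesc (mem S) (bound S) ≡ []
  noGaps = map≡[]⇒≡[] (gapsBelowDesc (mem S) (bound S)) youngS≡[]

  isNat : IsNat S
  isNat n with n <? bound S
  ... | yes n<bound = gapsBelowDesc≡[] (mem S) (bound S) noGaps n<bound
  ... | no n≮bound  = cofinite S n (≮⇒≥ n≮bound)

proposition5p1 : (S S̃ : NumericalSet) → ¬ IsNat S →
    young S̃ ≡ complementDiagram (young S) →
    c₁ S̃ ≡ c₁ S ∸ 1
proposition5p1 S S̃ S≢ℕ youngS̃≡ = begin
  c₁ S̃                                     ≡⟨ cong c₁Diagram youngS̃≡ ⟩
  c₁Diagram (complementDiagram (young S))  ≡⟨ c₁Diagram-complement (young-decreasing S) (young-positive S) (young≢[] S S≢ℕ) ⟩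
  c₁ S ∸ 1                                 ∎
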